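{- Let $V_n$ be the approximating graphs of the non-p.c.f. analog of the Sierpiński gasket (defined in the context), with vertex degrees $d_1,\dots,d_{|V_n|}$. Then for all $n\ge1$, $$\frac{\prod_{j=1}^{|V_n|}d_j}{\sum_{j=1}^{|V_n|}d_j}=2^{\frac1{25}(44\cdot6^n+30n+6)}\cdot3^{\frac15(6^n-5n-6)}.$$
   Context: The graphs $V_n$ are multigraphs (edges counted with multiplicity, degrees counted accordingly), each being a union of $6^n$ "cells", a cell being a triangle (three vertices with the three edges between them). $V_0$ is a single cell on vertices $x_1,x_2,x_3$. For $n\ge1$, $V_n$ is obtained from $V_{n-1}$ by replacing every cell with vertices $a,b,c$ by its barycentric subdivision: introduce four new vertices $u_{ab},u_{bc},u_{ca},o$ (new vertices introduced for different cells are distinct) and replace the cell by the six cells $\{a,u_{ab},o\},\{u_{ab},b,o\},\{b,u_{bc},o\},\{u_{bc},c,o\},\{c,u_{ca},o\},\{u_{ca},a,o\}$; the edge multiset of $V_n$ is the union (with multiplicity) of the edges of all its cells. -}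

module Defs where

open import Data.Nat as ℕ using (ℕ; zero; suc; _+_; _*_; _^_; _≡ᵇ_; NonZero)
open import Data.Nat.Properties using (m^n≢0)
open import Data.Bool using (if_then_else_)
open import Data.Product using (_×_; _,_)
open import Data.List using (List; []; _∷_; _++_; map; concatMap; length; upTo)
open import Data.Nat.ListAction using (sum; product)
open import Data.Integer as ℤ using (ℤ; +_; -[1+_])
import Data.Rational as ℚ

-- A multigraph given as a union of triangular cells.
-- Vertices are the natural numbers 0 , … , nV - 1; a cell is a triple of vertices.
Cell : Set
Cell = ℕ × ℕ × ℕ

record CellGraph : Set where
  constructor mkCG
  field
    nV    : ℕ
    cells : List Cell
open CellGraph public

subdivideCells : ℕ → List Cell → List Cell
subdivideCells base [] = []
subdivideCells base ((a , b , c) ∷ cs) =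
  let uab = base ; ubc = base + 1 ; uca = base + 2 ; o = base + 3 in
  (a , uab , o) ∷ (uab , b , o) ∷ (b , ubc , o) ∷ (ubc , c , o)
    ∷ (c , uca , o) ∷ (uca , a , o) ∷ subdivideCells (base + 4) cs

subdivide : CellGraph → CellGraph
subdivide (mkCG N cs) = mkCG (N + 4 * length cs) (subdivideCells N cs)

V : ℕ → CellGraph
V zero    = mkCG 3 ((0 , 1 , 2) ∷ [])
V (suc n) = subdivide (V n)

cellEdges : Cell → List (ℕ × ℕ)
cellEdges (a , b , c) = (a , b) ∷ (b , c) ∷ (c , a) ∷ []

edges : CellGraph → List (ℕ × ℕ)
edges G = concatMap cellEdges (cells G)

-- Degree (edges counted with multiplicity).
incidence : ℕ → ℕ × ℕ → ℕ
incidence v (x , y) = (if v ≡ᵇ x then 1 else 0) + (if v ≡ᵇ y then 1 else 0)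

degree : CellGraph → ℕ → ℕ
degree G v = sum (map (incidence v) (edges G))

degrees : CellGraph → List ℕ
degrees G = map (degree G) (upTo (nV G))

powℤ : (b : ℕ) → .{{_ : NonZero b}} → ℤ → ℚ.ℚ
powℤ b (+ k)      = (+ (b ^ k)) ℚ./ 1
powℤ b -[1+ k ]   = (+ 1) ℚ./ (b ^ suc k)
  where instance _ = m^n≢0 b (suc k)

module Submission where

-- Since every corner of a cell lies on two of its three edges,
-- deg v = 2 · (number of cells with corner v).  Subdividing a cell puts each old
-- corner and each edge point u into two of the six new cells and the barycentre
-- into all six, so (module SubdivisionDegrees) the degree list of a subdivided
-- graph is the old list doubled followed by 4, 4, 4, 12 for every old cell; this
-- needs the invariant that all corners are below the vertex count.  As V n has
-- 6^n cells and 4 · t n + 3 vertices, t n = 1 + 6 + ⋯ + 6^(n-1), module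
-- GasketDegrees derives Σ deg (V n) = 6^(n+1) and Π deg (V n) = 2^(E n + n + 1) · 3^(t n)
-- with 25 · E n = 44·6^n + 30n + 6; with G n = t n − (n+1), 5 · G n = 6^n − 5n − 6,
-- the ratio is 2^(E n) · 3^(G n) for n ≥ 2.  The theorem transports this identity
-- to ℚ; for n = 1 the exponent of 3 is −1 and the case is settled by evaluation.

module SubdivisionDegrees where
  open import Defs
  open import Data.Nat using (ℕ; zero; suc; _+_; _*_; _≤_; _<_; _≡ᵇ_; z<s; s<s)
  open import Data.Nat.Properties
  open import Data.List using (List; []; _∷_; _++_; map; length; applyUpTo; concat; replicate)
  open import Data.List.Properties using (map-upTo; map-applyUpTo)
  open import Data.List.Relation.Unary.All using (All; []; _∷_)
  open import Data.Product using (_×_; _,_)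
  open import Data.Bool using (true; false; if_then_else_; T)
  open import Data.Unit using (tt)
  open import Data.Empty using (⊥-elim)
  open import Relation.Binary.PropositionalEquality
  open import Data.Nat.Tactic.RingSolver using (solve-∀)
  open ≡-Reasoning

  applyUpTo-cong : ∀ {A : Set} (f g : ℕ → A) n → (∀ i → i < n → f i ≡ g i) →
    applyUpTo f n ≡ applyUpTo g n
  applyUpTo-cong f g zero    _   = refl
  applyUpTo-cong f g (suc n) f≗g = cong₂ _∷_ (f≗g 0 z<s)
    (applyUpTo-cong (λ i → f (suc i)) (λ i → g (suc i)) n (λ i i<n → f≗g (suc i) (s<s i<n)))

  applyUpTo-++ : ∀ {A : Set} (f : ℕ → A) m n →
    applyUpTo f (m + n) ≡ applyUpTo f m ++ applyUpTo (λ i → f (m + i)) n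
  applyUpTo-++ f zero    n = refl
  applyUpTo-++ f (suc m) n = cong (f 0 ∷_) (applyUpTo-++ (λ i → f (suc i)) m n)

  ind : ℕ → ℕ → ℕ
  ind v a = if v ≡ᵇ a then 1 else 0

  ind-≢ : ∀ {v a} → v ≢ a → ind v a ≡ 0
  ind-≢ {v} {a} v≢a with v ≡ᵇ a in eq
  ... | true  = ⊥-elim (v≢a (≡ᵇ⇒≡ v a (subst T (sym eq) tt)))
  ... | false = refl

  ind-< : ∀ {v a} → v < a → ind v a ≡ 0
  ind-< v<a = ind-≢ (<⇒≢ v<a)

  ind-> : ∀ {v a} → a < v → ind v a ≡ 0
  ind-> a<v = ind-≢ (>⇒≢ a<v)

  ind-shift : ∀ base j k → ind (base + j) (base + k) ≡ ind j k
  ind-shift zero       j k = refl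
  ind-shift (suc base) j k = ind-shift base j k

  ind-shift₀ : ∀ base j → ind (base + j) base ≡ ind j 0
  ind-shift₀ zero       j = refl
  ind-shift₀ (suc base) j = ind-shift₀ base j

  corners : ℕ → Cell → ℕ
  corners v (a , b , c) = ind v a + ind v b + ind v c

  occ : ℕ → List Cell → ℕ
  occ v []       = 0
  occ v (x ∷ cs) = corners v x + occ v cs

  -- Each corner of a cell lies on two of its three edges.
  degree-occ : ∀ N cs v → degree (mkCG N cs) v ≡ 2 * occ v cs
  degree-occ N []                 v = refl
  degree-occ N ((a , b , c) ∷ cs) v =
    trans (cong (λ r → (A + B) + ((B + C) + ((C + A) + r))) (degree-occ N cs v))
          (regroup A B C (occ v cs))
    where
    A = ind v a ; B = ind v b ; C = ind v c
    regroup : ∀ A B C R → (A + B) + ((B + C) + ((C + A) + 2 * R)) ≡ 2 * (A + B + C + R)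
    regroup = solve-∀

  degrees-occ : ∀ G → degrees G ≡ applyUpTo (λ v → 2 * occ v (cells G)) (nV G)
  degrees-occ (mkCG N cs) =
    trans (map-upTo (degree (mkCG N cs)) N) (applyUpTo-cong _ _ N (λ v _ → degree-occ N cs v))

  CellBelow : ℕ → Cell → Set
  CellBelow B (a , b , c) = a < B × b < B × c < B

  corners-unused : ∀ {B v} x → CellBelow B x → B ≤ v → corners v x ≡ 0
  corners-unused {B} {v} (a , b , c) (a<B , b<B , c<B) B≤v =
    cong₂ _+_ (cong₂ _+_ (absent a<B) (absent b<B)) (absent c<B)
    where
    absent : ∀ {x} → x < B → ind v x ≡ 0
    absent x<B = ind-> (<-≤-trans x<B B≤v)

  occ-unused : ∀ {B} v cs → All (CellBelow B) cs → B ≤ v → occ v cs ≡ 0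
  occ-unused v []       []             _   = refl
  occ-unused v (x ∷ cs) (x<B ∷ below) B≤v =
    cong₂ _+_ (corners-unused x x<B B≤v) (occ-unused v cs below B≤v)

  -- The number of the six cells replacing a cell that contain v as one of the
  -- fresh vertices base, …, base + 3: two for each edge point, six for the barycentre.
  freshCount : ℕ → ℕ → ℕ
  freshCount v base = 2 * (ind v base + ind v (base + 1) + ind v (base + 2)) + 6 * ind v (base + 3)

  freshCount-old : ∀ {v base} → v < base → freshCount v base ≡ 0
  freshCount-old {v} {base} v<base =
    cong₂ _+_ (cong (2 *_) (cong₂ _+_ (cong₂ _+_ (ind-< v<base) (absent 1)) (absent 2)))
              (cong (6 *_) (absent 3))
    where
    absent : ∀ k → ind v (base + k) ≡ 0
    absent k = ind-< (<-≤-trans v<base (m≤m+n base k))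

  freshCount-shift : ∀ base j → freshCount (base + j) base ≡ freshCount j 0
  freshCount-shift base j =
    cong₂ _+_ (cong (2 *_) (cong₂ _+_ (cong₂ _+_ (ind-shift₀ base j) (ind-shift base j 1))
                                      (ind-shift base j 2)))
              (cong (6 *_) (ind-shift base j 3))

  -- Corner count of v in the six cells replacing the first cell: each old corner
  -- lies in two of them.
  occ-subdivided-cell : ∀ v a b c base rest →
    occ v (subdivideCells base ((a , b , c) ∷ rest))
      ≡ 2 * corners v (a , b , c) + freshCount v base + occ v (subdivideCells (base + 4) rest)
  occ-subdivided-cell v a b c base rest =
    regroup (ind v a) (ind v b) (ind v c) (ind v base) (ind v (base + 1)) (ind v (base + 2))
            (ind v (base + 3)) (occ v (subdivideCells (base + 4) rest))
    where
    regroup : ∀ A B C U₁ U₂ U₃ O R →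
      A + U₁ + O + (U₁ + B + O + (B + U₂ + O + (U₂ + C + O + (C + U₃ + O + (U₃ + A + O + R)))))
        ≡ 2 * (A + B + C) + (2 * (U₁ + U₂ + U₃) + 6 * O) + R
    regroup = solve-∀

  -- An old vertex keeps its cells, each of which is now split into two around it.
  occ-old : ∀ v base cs → v < base → occ v (subdivideCells base cs) ≡ 2 * occ v cs
  occ-old v base []               _      = refl
  occ-old v base (x@(a , b , c) ∷ cs) v<base = begin
      occ v (subdivideCells base (x ∷ cs))
    ≡⟨ occ-subdivided-cell v a b c base cs ⟩
      2 * corners v x + freshCount v base + occ v (subdivideCells (base + 4) cs)
    ≡⟨ cong₂ (λ f r → 2 * corners v x + f + r) (freshCount-old v<base)
             (occ-old v (base + 4) cs (<-≤-trans v<base (m≤m+n base 4))) ⟩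
      2 * corners v x + 0 + 2 * occ v cs
    ≡⟨ cong (_+ 2 * occ v cs) (+-identityʳ (2 * corners v x)) ⟩
      2 * corners v x + 2 * occ v cs
    ≡⟨ *-distribˡ-+ 2 (corners v x) (occ v cs) ⟨
      2 * occ v (x ∷ cs) ∎

  -- A fresh vertex base + j of the first cell lies only in the six cells replacing it.
  occ-fresh-head : ∀ {B} base a b c cs j → All (CellBelow B) ((a , b , c) ∷ cs) → B ≤ base →
    j < 4 → occ (base + j) (subdivideCells base ((a , b , c) ∷ cs)) ≡ freshCount j 0
  occ-fresh-head base a b c cs j (x<B ∷ below) B≤base j<4 = begin
      occ (base + j) (subdivideCells base ((a , b , c) ∷ cs))
    ≡⟨ occ-subdivided-cell (base + j) a b c base cs ⟩
      2 * corners (base + j) (a , b , c) + freshCount (base + j) base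
        + occ (base + j) (subdivideCells (base + 4) cs)
    ≡⟨ cong₂ (λ k r → 2 * k + freshCount (base + j) base + r)
             (corners-unused (a , b , c) x<B (≤-trans B≤base (m≤m+n base j)))
             (trans (occ-old (base + j) (base + 4) cs (+-monoʳ-< base j<4))
                    (cong (2 *_) (occ-unused (base + j) cs below (≤-trans B≤base (m≤m+n base j))))) ⟩
      freshCount (base + j) base + 0
    ≡⟨ +-identityʳ _ ⟩
      freshCount (base + j) base
    ≡⟨ freshCount-shift base j ⟩
      freshCount j 0 ∎

  occ-fresh-tail : ∀ {B} base a b c cs i → All (CellBelow B) ((a , b , c) ∷ cs) → B ≤ base →
    occ (base + (4 + i)) (subdivideCells base ((a , b , c) ∷ cs))
      ≡ occ (base + 4 + i) (subdivideCells (base + 4) cs)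
  occ-fresh-tail base a b c cs i (x<B ∷ _) B≤base = begin
      occ v (subdivideCells base ((a , b , c) ∷ cs))
    ≡⟨ occ-subdivided-cell v a b c base cs ⟩
      2 * corners v (a , b , c) + freshCount v base + occ v (subdivideCells (base + 4) cs)
    ≡⟨ cong₂ (λ k f → 2 * k + f + occ v (subdivideCells (base + 4) cs))
             (corners-unused (a , b , c) x<B (≤-trans B≤base (m≤m+n base (4 + i))))
             (freshCount-shift base (4 + i)) ⟩
      occ v (subdivideCells (base + 4) cs)
    ≡⟨ cong (λ w → occ w (subdivideCells (base + 4) cs)) (+-assoc base 4 i) ⟨
      occ (base + 4 + i) (subdivideCells (base + 4) cs) ∎
    where
    v = base + (4 + i)

  freshDegrees : ℕ → List ℕ
  freshDegrees k = concat (replicate k (4 ∷ 4 ∷ 4 ∷ 12 ∷ []))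

  fresh-degrees : ∀ {B} base cs → All (CellBelow B) cs → B ≤ base →
    applyUpTo (λ j → 2 * occ (base + j) (subdivideCells base cs)) (4 * length cs)
      ≡ freshDegrees (length cs)
  fresh-degrees base [] [] _ = refl
  fresh-degrees base ((a , b , c) ∷ cs) below@(_ ∷ below′) B≤base = begin
      applyUpTo f (4 * suc (length cs))
    ≡⟨ cong (applyUpTo f) (*-suc 4 (length cs)) ⟩
      applyUpTo f (4 + 4 * length cs)
    ≡⟨ applyUpTo-++ f 4 (4 * length cs) ⟩
      applyUpTo f 4 ++ applyUpTo (λ i → f (4 + i)) (4 * length cs)
    ≡⟨ cong₂ _++_ first-cell remaining-cells ⟩
      freshDegrees (suc (length cs)) ∎
    where
    f : ℕ → ℕ
    f j = 2 * occ (base + j) (subdivideCells base ((a , b , c) ∷ cs))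
    first-cell : applyUpTo f 4 ≡ 4 ∷ 4 ∷ 4 ∷ 12 ∷ []
    first-cell = applyUpTo-cong f (λ j → 2 * freshCount j 0) 4
      (λ j j<4 → cong (2 *_) (occ-fresh-head base a b c cs j below B≤base j<4))
    remaining-cells : applyUpTo (λ i → f (4 + i)) (4 * length cs) ≡ freshDegrees (length cs)
    remaining-cells = trans
      (applyUpTo-cong _ _ (4 * length cs) (λ i _ → cong (2 *_) (occ-fresh-tail base a b c cs i below B≤base)))
      (fresh-degrees (base + 4) cs below′ (≤-trans B≤base (m≤m+n base 4)))

  degrees-subdivide : ∀ G → All (CellBelow (nV G)) (cells G) →
    degrees (subdivide G) ≡ map (2 *_) (degrees G) ++ freshDegrees (length (cells G))
  degrees-subdivide G@(mkCG N cs) below = begin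
      degrees (subdivide G)
    ≡⟨ degrees-occ (subdivide G) ⟩
      applyUpTo d′ (N + 4 * length cs)
    ≡⟨ applyUpTo-++ d′ N (4 * length cs) ⟩
      applyUpTo d′ N ++ applyUpTo (λ j → d′ (N + j)) (4 * length cs)
    ≡⟨ cong₂ _++_ old-vertices (fresh-degrees N cs below ≤-refl) ⟩
      map (2 *_) (degrees G) ++ freshDegrees (length cs) ∎
    where
    d′ : ℕ → ℕ
    d′ v = 2 * occ v (subdivideCells N cs)
    old-vertices : applyUpTo d′ N ≡ map (2 *_) (degrees G)
    old-vertices = begin
        applyUpTo d′ N
      ≡⟨ applyUpTo-cong _ _ N (λ v v<N → cong (2 *_) (occ-old v N cs v<N)) ⟩
        applyUpTo (λ v → 2 * (2 * occ v cs)) N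
      ≡⟨ map-applyUpTo (λ v → 2 * occ v cs) (2 *_) N ⟨
        map (2 *_) (applyUpTo (λ v → 2 * occ v cs) N)
      ≡⟨ cong (map (2 *_)) (degrees-occ G) ⟨
        map (2 *_) (degrees G) ∎

  length-subdivideCells : ∀ base cs → length (subdivideCells base cs) ≡ 6 * length cs
  length-subdivideCells base []       = refl
  length-subdivideCells base (_ ∷ cs) =
    trans (cong (6 +_) (length-subdivideCells (base + 4) cs)) (sym (*-suc 6 (length cs)))

  subdivideCells-below : ∀ {B T} base cs → All (CellBelow B) cs → B ≤ base →
    base + 4 * length cs ≤ T → All (CellBelow T) (subdivideCells base cs)
  subdivideCells-below base [] [] _ _ = []
  subdivideCells-below {B} {T} base ((a , b , c) ∷ cs) ((a<B , b<B , c<B) ∷ below) B≤base bound =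
      (old a<B , u₀ , o) ∷ (u₀ , old b<B , o) ∷ (old b<B , u₁ , o)
    ∷ (u₁ , old c<B , o) ∷ (old c<B , u₂ , o) ∷ (u₂ , old a<B , o)
    ∷ subdivideCells-below (base + 4) cs below (≤-trans B≤base (m≤m+n base 4)) rest
    where
    rest : base + 4 + 4 * length cs ≤ T
    rest = ≤-trans (≤-reflexive (trans (+-assoc base 4 _)
                                        (cong (base +_) (sym (*-suc 4 (length cs)))))) bound
    block : base + 4 ≤ T
    block = ≤-trans (m≤m+n (base + 4) _) rest
    old : ∀ {x} → x < B → x < T
    old x<B = <-≤-trans x<B (≤-trans B≤base (≤-trans (m≤m+n base 4) block))
    u₀ : base < T
    u₀ = <-≤-trans (m<m+n base z<s) block
    fresh : ∀ {k} → k < 4 → base + k < T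
    fresh k<4 = <-≤-trans (+-monoʳ-< base k<4) block
    u₁ : base + 1 < T
    u₁ = fresh (s<s z<s)
    u₂ : base + 2 < T
    u₂ = fresh (s<s (s<s z<s))
    o : base + 3 < T
    o = fresh (s<s (s<s (s<s z<s)))

module GasketDegrees where
  open import Defs
  open import Data.Nat using (ℕ; zero; suc; _+_; _*_; _^_; _∸_; _≤_; z≤n; s≤s; z<s; s<s)
  open import Data.Nat.Properties
  open import Data.Nat.ListAction using (sum; product)
  open import Data.Nat.ListAction.Properties using (sum-++; product-++)
  open import Data.List using ([]; _∷_; _++_; map; length; upTo)
  open import Data.List.Properties using (length-map; length-upTo)
  open import Data.List.Relation.Unary.All using (All; _∷_; [])
  open import Data.Product using (_,_)
  open import Relation.Binary.PropositionalEquality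
  open import Data.Nat.Tactic.RingSolver using (solve-∀)
  open ≡-Reasoning
  open SubdivisionDegrees using (CellBelow; freshDegrees; degrees-subdivide;
                                 length-subdivideCells; subdivideCells-below)

  sum-double : ∀ xs → sum (map (2 *_) xs) ≡ 2 * sum xs
  sum-double []       = refl
  sum-double (x ∷ xs) =
    trans (cong (2 * x +_) (sum-double xs)) (sym (*-distribˡ-+ 2 x (sum xs)))

  product-double : ∀ xs → product (map (2 *_) xs) ≡ 2 ^ length xs * product xs
  product-double []       = refl
  product-double (x ∷ xs) =
    trans (cong (2 * x *_) (product-double xs)) (regroup x (2 ^ length xs) (product xs))
    where
    regroup : ∀ x y z → 2 * x * (y * z) ≡ 2 * y * (x * z)
    regroup = solve-∀

  sum-freshDegrees : ∀ k → sum (freshDegrees k) ≡ 24 * k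
  sum-freshDegrees zero    = refl
  sum-freshDegrees (suc k) = trans (cong (24 +_) (sum-freshDegrees k)) (sym (*-suc 24 k))

  product-freshDegrees : ∀ k → product (freshDegrees k) ≡ 768 ^ k
  product-freshDegrees zero    = refl
  product-freshDegrees (suc k) =
    trans (cong (λ p → 4 * (4 * (4 * (12 * p)))) (product-freshDegrees k)) (regroup (768 ^ k))
    where
    regroup : ∀ p → 4 * (4 * (4 * (12 * p))) ≡ 768 * p
    regroup = solve-∀

  length-degrees : ∀ G → length (degrees G) ≡ nV G
  length-degrees G = trans (length-map (degree G) (upTo (nV G))) (length-upTo (nV G))

  pow-* : ∀ a b k → (a * b) ^ k ≡ a ^ k * b ^ k
  pow-* a b zero    = refl
  pow-* a b (suc k) = trans (cong (a * b *_) (pow-* a b k)) (regroup a b (a ^ k) (b ^ k))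
    where
    regroup : ∀ a b x y → a * b * (x * y) ≡ a * x * (b * y)
    regroup = solve-∀

  pow-768 : ∀ k → 768 ^ k ≡ 2 ^ (8 * k) * 3 ^ k
  pow-768 k = trans (pow-* (2 ^ 8) 3 k) (cong (_* 3 ^ k) (^-*-assoc 2 8 k))

  collect-powers : ∀ a b c d e →
    2 ^ a * (2 ^ b * 3 ^ c) * (2 ^ d * 3 ^ e) ≡ 2 ^ (a + b + d) * 3 ^ (c + e)
  collect-powers a b c d e = begin
      2 ^ a * (2 ^ b * 3 ^ c) * (2 ^ d * 3 ^ e)
    ≡⟨ regroup (2 ^ a) (2 ^ b) (3 ^ c) (2 ^ d) (3 ^ e) ⟩
      2 ^ a * 2 ^ b * 2 ^ d * (3 ^ c * 3 ^ e)
    ≡⟨ cong₂ _*_ (cong (_* 2 ^ d) (^-distribˡ-+-* 2 a b)) (^-distribˡ-+-* 3 c e) ⟨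
      2 ^ (a + b) * 2 ^ d * 3 ^ (c + e)
    ≡⟨ cong (_* 3 ^ (c + e)) (^-distribˡ-+-* 2 (a + b) d) ⟨
      2 ^ (a + b + d) * 3 ^ (c + e) ∎
    where
    regroup : ∀ x y z u w → x * (y * z) * (u * w) ≡ x * y * u * (z * w)
    regroup = solve-∀

  split-powers : ∀ a b k → 2 ^ (a + k) * 3 ^ (b + k) ≡ 6 ^ k * (2 ^ a * 3 ^ b)
  split-powers a b k = begin
      2 ^ (a + k) * 3 ^ (b + k)
    ≡⟨ cong₂ _*_ (^-distribˡ-+-* 2 a k) (^-distribˡ-+-* 3 b k) ⟩
      2 ^ a * 2 ^ k * (3 ^ b * 3 ^ k)
    ≡⟨ regroup (2 ^ a) (2 ^ k) (3 ^ b) (3 ^ k) ⟩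
      2 ^ k * 3 ^ k * (2 ^ a * 3 ^ b)
    ≡⟨ cong (_* (2 ^ a * 3 ^ b)) (pow-* 2 3 k) ⟨
      6 ^ k * (2 ^ a * 3 ^ b) ∎
    where
    regroup : ∀ x y z u → x * y * (z * u) ≡ y * u * (x * z)
    regroup = solve-∀

  t : ℕ → ℕ
  t zero    = 0
  t (suc n) = 6 ^ n + t n

  geometric-sum : ∀ n → 5 * t n + 1 ≡ 6 ^ n
  geometric-sum zero    = refl
  geometric-sum (suc n) = begin
      5 * (6 ^ n + t n) + 1     ≡⟨ regroup (6 ^ n) (t n) ⟩
      5 * 6 ^ n + (5 * t n + 1) ≡⟨ cong (5 * 6 ^ n +_) (geometric-sum n) ⟩
      5 * 6 ^ n + 6 ^ n         ≡⟨ regroup′ (6 ^ n) ⟩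
      6 * 6 ^ n                 ∎
    where
    regroup : ∀ x y → 5 * (x + y) + 1 ≡ 5 * x + (5 * y + 1)
    regroup = solve-∀
    regroup′ : ∀ x → 5 * x + x ≡ 6 * x
    regroup′ = solve-∀

  -- E n, the exponent of 2 in the ratio Π deg / Σ deg for V n.
  E : ℕ → ℕ
  E zero    = 2
  E (suc n) = E n + 44 * t n + 10

  E-closed : ∀ n → 44 * 6 ^ n + 30 * n + 6 ≡ E n * 25
  E-closed zero    = refl
  E-closed (suc n) = begin
      44 * 6 ^ suc n + 30 * suc n + 6
    ≡⟨ cong (λ x → 44 * (6 * x) + 30 * suc n + 6) (geometric-sum n) ⟨
      44 * (6 * (5 * t n + 1)) + 30 * suc n + 6
    ≡⟨ regroup (t n) n ⟩
      44 * (5 * t n + 1) + 30 * n + 6 + (1100 * t n + 250)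
    ≡⟨ cong (λ x → 44 * x + 30 * n + 6 + (1100 * t n + 250)) (geometric-sum n) ⟩
      44 * 6 ^ n + 30 * n + 6 + (1100 * t n + 250)
    ≡⟨ cong (_+ (1100 * t n + 250)) (E-closed n) ⟩
      E n * 25 + (1100 * t n + 250)
    ≡⟨ regroup′ (E n) (t n) ⟩
      E (suc n) * 25 ∎
    where
    regroup : ∀ x k → 44 * (6 * (5 * x + 1)) + 30 * suc k + 6
                        ≡ 44 * (5 * x + 1) + 30 * k + 6 + (1100 * x + 250)
    regroup = solve-∀
    regroup′ : ∀ e x → e * 25 + (1100 * x + 250) ≡ (e + 44 * x + 10) * 25
    regroup′ = solve-∀

  -- Exponent of 2 across one subdivision: the product gains 2^|V n| · 2^(8·6^n).
  E-step : ∀ n → 4 * t n + 3 + (E n + suc n) + 8 * 6 ^ n ≡ E (suc n) + suc (suc n)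
  E-step n = begin
      4 * t n + 3 + (E n + suc n) + 8 * 6 ^ n
    ≡⟨ cong (λ x → 4 * t n + 3 + (E n + suc n) + 8 * x) (geometric-sum n) ⟨
      4 * t n + 3 + (E n + suc n) + 8 * (5 * t n + 1)
    ≡⟨ regroup (t n) (E n) n ⟩
      E (suc n) + suc (suc n) ∎
    where
    regroup : ∀ x e k → 4 * x + 3 + (e + suc k) + 8 * (5 * x + 1) ≡ e + 44 * x + 10 + suc (suc k)
    regroup = solve-∀

  -- G n, the exponent of 3 in the ratio; meaningful once t n > n, i.e. for n ≥ 2.
  G : ℕ → ℕ
  G n = t n ∸ suc n

  t-large : ∀ m → 3 + m ≤ t (2 + m)
  t-large zero    = s≤s (s≤s (s≤s z≤n))
  t-large (suc m) = +-mono-≤ (m^n>0 6 (2 + m)) (t-large m)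

  t-split : ∀ m → t (2 + m) ≡ G (2 + m) + (3 + m)
  t-split m = sym (m∸n+n≡m (t-large m))

  G-closed : ∀ m → 6 ^ (2 + m) ≡ G (2 + m) * 5 + (5 * (2 + m) + 6)
  G-closed m = begin
      6 ^ (2 + m)                    ≡⟨ geometric-sum (2 + m) ⟨
      5 * t (2 + m) + 1              ≡⟨ cong (λ x → 5 * x + 1) (t-split m) ⟩
      5 * (G (2 + m) + (3 + m)) + 1  ≡⟨ regroup (G (2 + m)) m ⟩
      G (2 + m) * 5 + (5 * (2 + m) + 6) ∎
    where
    regroup : ∀ g k → 5 * (g + (3 + k)) + 1 ≡ g * 5 + (5 * (2 + k) + 6)
    regroup = solve-∀

  cellCount : ∀ n → length (cells (V n)) ≡ 6 ^ n
  cellCount zero    = refl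
  cellCount (suc n) = trans (length-subdivideCells (nV (V n)) (cells (V n))) (cong (6 *_) (cellCount n))

  vertexCount : ∀ n → nV (V n) ≡ 4 * t n + 3
  vertexCount zero    = refl
  vertexCount (suc n) = begin
      nV (V n) + 4 * length (cells (V n))  ≡⟨ cong₂ (λ v c → v + 4 * c) (vertexCount n) (cellCount n) ⟩
      4 * t n + 3 + 4 * 6 ^ n              ≡⟨ regroup (t n) (6 ^ n) ⟩
      4 * (6 ^ n + t n) + 3                ∎
    where
    regroup : ∀ x y → 4 * x + 3 + 4 * y ≡ 4 * (y + x) + 3
    regroup = solve-∀

  cornersBelow : ∀ n → All (CellBelow (nV (V n))) (cells (V n))
  cornersBelow zero    = (z<s , s<s z<s , s<s (s<s z<s)) ∷ []
  cornersBelow (suc n) =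
    subdivideCells-below (nV (V n)) (cells (V n)) (cornersBelow n) ≤-refl ≤-refl

  degrees-step : ∀ n → degrees (V (suc n)) ≡ map (2 *_) (degrees (V n)) ++ freshDegrees (6 ^ n)
  degrees-step n = trans (degrees-subdivide (V n) (cornersBelow n))
    (cong (λ k → map (2 *_) (degrees (V n)) ++ freshDegrees k) (cellCount n))

  degreeSum : ∀ n → sum (degrees (V n)) ≡ 6 ^ suc n
  degreeSum zero    = refl
  degreeSum (suc n) = begin
      sum (degrees (V (suc n)))
    ≡⟨ cong sum (degrees-step n) ⟩
      sum (map (2 *_) D ++ freshDegrees (6 ^ n))
    ≡⟨ sum-++ (map (2 *_) D) (freshDegrees (6 ^ n)) ⟩
      sum (map (2 *_) D) + sum (freshDegrees (6 ^ n))
    ≡⟨ cong₂ _+_ (trans (sum-double D) (cong (2 *_) (degreeSum n))) (sum-freshDegrees (6 ^ n)) ⟩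
      2 * (6 * 6 ^ n) + 24 * 6 ^ n
    ≡⟨ regroup (6 ^ n) ⟩
      6 ^ suc (suc n) ∎
    where
    D = degrees (V n)
    regroup : ∀ x → 2 * (6 * x) + 24 * x ≡ 6 * (6 * x)
    regroup = solve-∀

  degreeProduct : ∀ n → product (degrees (V n)) ≡ 2 ^ (E n + suc n) * 3 ^ t n
  degreeProduct zero    = refl
  degreeProduct (suc n) = begin
      product (degrees (V (suc n)))
    ≡⟨ cong product (degrees-step n) ⟩
      product (map (2 *_) D ++ freshDegrees (6 ^ n))
    ≡⟨ product-++ (map (2 *_) D) (freshDegrees (6 ^ n)) ⟩
      product (map (2 *_) D) * product (freshDegrees (6 ^ n))
    ≡⟨ cong₂ _*_ (product-double D) (trans (product-freshDegrees (6 ^ n)) (pow-768 (6 ^ n))) ⟩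
      2 ^ length D * product D * (2 ^ (8 * 6 ^ n) * 3 ^ 6 ^ n)
    ≡⟨ cong₂ (λ v p → 2 ^ v * p * (2 ^ (8 * 6 ^ n) * 3 ^ 6 ^ n))
             (trans (length-degrees (V n)) (vertexCount n)) (degreeProduct n) ⟩
      2 ^ (4 * t n + 3) * (2 ^ (E n + suc n) * 3 ^ t n) * (2 ^ (8 * 6 ^ n) * 3 ^ 6 ^ n)
    ≡⟨ collect-powers (4 * t n + 3) (E n + suc n) (t n) (8 * 6 ^ n) (6 ^ n) ⟩
      2 ^ (4 * t n + 3 + (E n + suc n) + 8 * 6 ^ n) * 3 ^ (t n + 6 ^ n)
    ≡⟨ cong₂ (λ a b → 2 ^ a * 3 ^ b) (E-step n) (+-comm (t n) (6 ^ n)) ⟩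
      2 ^ (E (suc n) + suc (suc n)) * 3 ^ t (suc n) ∎
    where
    D = degrees (V n)

  degree-ratio : ∀ m → product (degrees (V (2 + m)))
                         ≡ sum (degrees (V (2 + m))) * (2 ^ E (2 + m) * 3 ^ G (2 + m))
  degree-ratio m = begin
      product (degrees (V n))
    ≡⟨ degreeProduct n ⟩
      2 ^ (E n + suc n) * 3 ^ t n
    ≡⟨ cong (λ x → 2 ^ (E n + suc n) * 3 ^ x) (t-split m) ⟩
      2 ^ (E n + suc n) * 3 ^ (G n + suc n)
    ≡⟨ split-powers (E n) (G n) (suc n) ⟩
      6 ^ suc n * (2 ^ E n * 3 ^ G n)
    ≡⟨ cong (_* (2 ^ E n * 3 ^ G n)) (degreeSum n) ⟨
      sum (degrees (V n)) * (2 ^ E n * 3 ^ G n) ∎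
    where
    n = 2 + m

open import Defs
open import Data.Nat as ℕ using (ℕ; _≤_; _^_)
open import Data.Nat.ListAction using (sum; product)
open import Data.Integer as ℤ using (+_; _-_)
open import Data.Rational as ℚ using (_*_)
open import Relation.Binary.PropositionalEquality using (_≡_)

open import Data.Nat using (zero; suc)
open import Data.Nat.Properties using (m≤n+m; m+n∸n≡m)
open import Data.Nat.DivMod using (m*n/n≡m)
open import Data.Nat.Coprimality using (1-coprimeTo) renaming (sym to coprime-sym)
open import Data.Rational.Properties using (normalize-coprime)
import Data.Integer.Properties as ℤₚ
open import Relation.Binary.PropositionalEquality using (refl; sym; trans; cong; cong₂; module ≡-Reasoning)
open GasketDegrees using (E; G; E-closed; G-closed; degree-ratio)

fromℕ-* : ∀ m k → ((+ m) ℚ./ 1) * ((+ k) ℚ./ 1) ≡ (+ (m ℕ.* k)) ℚ./ 1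
fromℕ-* m k rewrite normalize-coprime (coprime-sym (1-coprimeTo m))
                  | normalize-coprime (coprime-sym (1-coprimeTo k)) =
  cong (ℚ._/ 1) (sym (ℤₚ.pos-* m k))

exact-div : ∀ q d .{{_ : ℕ.NonZero d}} → (+ (q ℕ.* d)) ℤ./ (+ d) ≡ + q
exact-div q d = trans (ℤₚ.*-identityˡ _) (cong +_ (m*n/n≡m q d))

exact-sub : ∀ a b → + (a ℕ.+ b) - + b ≡ + a
exact-sub a b =
  trans (ℤₚ.m-n≡m⊖n (a ℕ.+ b) b) (trans (ℤₚ.⊖-≥ (m≤n+m b a)) (cong +_ (m+n∸n≡m a b)))

exponent-of-2 : ∀ n → (+ (44 ℕ.* 6 ^ n ℕ.+ 30 ℕ.* n ℕ.+ 6)) ℤ./ (+ 25) ≡ + E n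
exponent-of-2 n = trans (cong (λ x → (+ x) ℤ./ (+ 25)) (E-closed n)) (exact-div (E n) 25)

exponent-of-3 : ∀ m → (+ (6 ^ (2 ℕ.+ m)) - + (5 ℕ.* (2 ℕ.+ m) ℕ.+ 6)) ℤ./ (+ 5) ≡ + G (2 ℕ.+ m)
exponent-of-3 m = trans (cong (λ x → (+ x - + k) ℤ./ (+ 5)) (G-closed m))
  (trans (cong (ℤ._/ (+ 5)) (exact-sub (G (2 ℕ.+ m) ℕ.* 5) k)) (exact-div (G (2 ℕ.+ m)) 5))
  where k = 5 ℕ.* (2 ℕ.+ m) ℕ.+ 6

corollary5p5 : (n : ℕ) → 1 ≤ n →
    (+ product (degrees (V n))) ℚ./ 1
      ≡ ((+ sum (degrees (V n))) ℚ./ 1)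
        * (powℤ 2 ((+ (44 ℕ.* 6 ^ n ℕ.+ 30 ℕ.* n ℕ.+ 6)) ℤ./ (+ 25))
          * powℤ 3 ((+ (6 ^ n) - + (5 ℕ.* n ℕ.+ 6)) ℤ./ (+ 5)))
-- For n = 1 the exponent of 3 is −1: V 1 has degrees 4,4,4,4,4,4,12, and
-- 2^14 · 3 / 36 = 2^12 / 3 is checked by evaluation.
corollary5p5 (suc zero)    _ = refl
corollary5p5 (suc (suc m)) _ = begin
    (+ product (degrees (V n))) ℚ./ 1
  ≡⟨ cong (λ p → (+ p) ℚ./ 1) (degree-ratio m) ⟩
    (+ (S ℕ.* (2 ^ E n ℕ.* 3 ^ G n))) ℚ./ 1
  ≡⟨ trans (cong (((+ S) ℚ./ 1) *_) (fromℕ-* (2 ^ E n) (3 ^ G n))) (fromℕ-* S _) ⟨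
    ((+ S) ℚ./ 1) * (powℤ 2 (+ E n) * powℤ 3 (+ G n))
  ≡⟨ cong₂ (λ a b → ((+ S) ℚ./ 1) * (powℤ 2 a * powℤ 3 b)) (exponent-of-2 n) (exponent-of-3 m) ⟨
    ((+ S) ℚ./ 1) * (powℤ 2 ((+ (44 ℕ.* 6 ^ n ℕ.+ 30 ℕ.* n ℕ.+ 6)) ℤ./ (+ 25))
      * powℤ 3 ((+ (6 ^ n) - + (5 ℕ.* n ℕ.+ 6)) ℤ./ (+ 5))) ∎
  where
  open ≡-Reasoning
  n = suc (suc m)
  S = sum (degrees (V n))
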